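{- Let $a,c\ge 2$ be even integers with $a\ne c$. Then $U=\{(a,-a),(c,-c)\}\subseteq\mathcal{B}$ is unavoidable in $\mathcal{B}$.
   Context: The bicyclic inverse semigroup is $\mathcal{B}=\{(a,b)\in\mathbb{Z}\times\mathbb{Z}\mid a\ge 0,\ a+b\ge 0\}$ with multiplication $(a,b)(c,d)=(\max\{c+d,a\}-d,\ b+d)$. A subset $U\subseteq\mathcal{B}$ is avoidable if $\mathcal{B}$ can be partitioned into two sets $A$ and $B$ such that no element of $U$ is a product $st$ of two distinct elements $s\ne t$ both in $A$ or both in $B$; otherwise $U$ is unavoidable. -}

module Defs where

open import Data.Integer using (ℤ; +_; _+_; _-_; -_; _≥_; _⊔_)
open import Data.Product using (_×_; _,_; Σ; ∃; ∃-syntax; proj₁; proj₂)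
open import Data.Bool using (Bool)
open import Relation.Binary.PropositionalEquality using (_≡_; _≢_)

InB : ℤ × ℤ → Set
InB (a , b) = (a ≥ + 0) × (a + b ≥ + 0)

Bicyclic : Set
Bicyclic = Σ (ℤ × ℤ) InB

_·_ : ℤ × ℤ → ℤ × ℤ → ℤ × ℤ
(a , b) · (c , d) = (((c + d) ⊔ a) - d , b + d)

Subset : Set₁
Subset = ℤ × ℤ → Set

-- U is avoidable: there is a partition of ℬ into two sets A, B (a 2-colouring)
-- such that no element of U is a product st of distinct s ≠ t of the same colour.
Avoidable : Subset → Set
Avoidable U = Σ (Bicyclic → Bool) λ col →
  (s t : Bicyclic) → proj₁ s ≢ proj₁ t → col s ≡ col t →
  U (proj₁ s · proj₁ t) → Data.Empty.⊥
  where import Data.Empty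

Unavoidable : Subset → Set
Unavoidable U = Avoidable U → Data.Empty.⊥
  where import Data.Empty

module Submission where

-- A 2-colouring of ℬ cannot separate three pairwise distinct
-- elements s, t, u: two of them share a colour.  So U is unavoidable as soon
-- as there are three distinct elements whose three products s·t, s·u, u·t all
-- lie in U (lemma triangle⇒unavoidable).
--
-- For U = {(2k,-2k), (c,-c)} with 1 ≤ k, c - k ≥ 1 and c ≠ 2k take
--   s = (k, -k),   t = (k+1, -k),   u = (c-k, k-c).
-- Every product involved has its right factor (x,y) with x + y ≤ (left first
-- coordinate), where the multiplication is simply (a,b)(x,y) = (a - y, b + y)
-- (lemma ·-dominated); this gives s·t = (2k,-2k) and s·u = u·t = (c,-c).
--
-- For the theorem, order a and c (unavoidability is monotone in U, which
-- handles the symmetric case), write the smaller one as a = 2k using evenness,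
-- and apply the construction.

open import Defs
open import Data.Integer using (ℤ; +_; -_; _≥_; _≤_; _+_; _-_; suc; +≤+)
open import Data.Integer.Divisibility using (_∣_)
open import Data.Integer.Properties
  using ( ≤-refl; ≤-trans; ≤-reflexive; ≤-total; i≤j⇒i⊔j≡j; i≤j⇒i≤1+j
        ; +-monoˡ-≤; +-inverseʳ; i≢suc[i])
open import Data.Integer.Tactic.RingSolver using (solve-∀)
import Data.Nat as ℕ
import Data.Nat.Properties as ℕ
open import Data.Nat.Divisibility using (divides)
open import Data.Bool using (Bool; true; false)
open import Data.Product using (∃; _×_; _,_; proj₁; proj₂)
open import Data.Sum using (_⊎_; inj₁; inj₂; swap)
open import Function using (_∘_)
open import Relation.Binary.PropositionalEquality
  using (_≡_; _≢_; refl; sym; trans; cong; cong₂; module ≡-Reasoning)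

Pair : ℤ → ℤ → Subset
Pair a c p = (p ≡ (a , - a)) ⊎ (p ≡ (c , - c))

Pair-swap : (a c : ℤ) → ∀ p → Pair a c p → Pair c a p
Pair-swap a c p = swap

pigeonhole : (x y z : Bool) → x ≡ y ⊎ x ≡ z ⊎ y ≡ z
pigeonhole false false _     = inj₁ refl
pigeonhole true  true  _     = inj₁ refl
pigeonhole false true  false = inj₂ (inj₁ refl)
pigeonhole true  false true  = inj₂ (inj₁ refl)
pigeonhole false true  true  = inj₂ (inj₂ refl)
pigeonhole true  false false = inj₂ (inj₂ refl)

unavoidable-mono : {U V : Subset} → (∀ p → U p → V p) → Unavoidable U → Unavoidable V
unavoidable-mono U⊆V U-unavoidable (col , avoids) =
  U-unavoidable (col , λ s t s≢t same st∈U → avoids s t s≢t same (U⊆V _ st∈U))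

triangle⇒unavoidable : (U : Subset) (s t u : Bicyclic) →
  proj₁ s ≢ proj₁ t → proj₁ s ≢ proj₁ u → proj₁ u ≢ proj₁ t →
  U (proj₁ s · proj₁ t) → U (proj₁ s · proj₁ u) → U (proj₁ u · proj₁ t) →
  Unavoidable U
triangle⇒unavoidable U s t u s≢t s≢u u≢t st∈U su∈U ut∈U (col , avoids)
  with pigeonhole (col s) (col t) (col u)
... | inj₁ s~t        = avoids s t s≢t s~t st∈U
... | inj₂ (inj₁ s~u) = avoids s u s≢u s~u su∈U
... | inj₂ (inj₂ t~u) = avoids u t u≢t (sym t~u) ut∈U

-- When x + y ≤ a the maximum in the multiplication is a, so the product is
-- (a - y, b + y).
·-dominated : (a b x y : ℤ) → x + y ≤ a → (a , b) · (x , y) ≡ (a - y , b + y)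
·-dominated a b x y x+y≤a = cong (λ m → (m - y , b + y)) (i≤j⇒i⊔j≡j x+y≤a)

≡0⇒≥0 : {x : ℤ} → x ≡ + 0 → x ≥ + 0
≡0⇒≥0 refl = ≤-refl

suc-x-x : ∀ x → (+ 1 + x) + - x ≡ + 1
suc-x-x = solve-∀
sum-cancel : ∀ x y → (y - x) + (x - y) ≡ + 0
sum-cancel = solve-∀
x--x : ∀ x → x - - x ≡ x + x
x--x = solve-∀
-x+-x : ∀ x → - x + - x ≡ - (x + x)
-x+-x = solve-∀
x-[x-y] : ∀ x y → x - (x - y) ≡ y
x-[x-y] = solve-∀
-x+[x-y] : ∀ x y → - x + (x - y) ≡ - y
-x+[x-y] = solve-∀
[y-x]--x : ∀ x y → (y - x) - - x ≡ y
[y-x]--x = solve-∀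
[x-y]+-x : ∀ x y → (x - y) + - x ≡ - y
[x-y]+-x = solve-∀

unavoidable-double : (k c : ℤ) → + 1 ≤ k → + 1 ≤ c - k → c ≢ k + k →
  Unavoidable (Pair (k + k) c)
unavoidable-double k c k≥1 c-k≥1 c≢2k =
  triangle⇒unavoidable (Pair (k + k) c) s t u s≢t s≢u u≢t
    (inj₁ st) (inj₂ su) (inj₂ ut)
  where
  0≤1 : + 0 ≤ + 1
  0≤1 = +≤+ ℕ.z≤n
  k≥0 : k ≥ + 0
  k≥0 = ≤-trans 0≤1 k≥1

  s t u : Bicyclic
  s = (k , - k) , k≥0 , ≡0⇒≥0 (+-inverseʳ k)
  t = (suc k , - k) , i≤j⇒i≤1+j k≥0 , ≤-trans 0≤1 (≤-reflexive (sym (suc-x-x k)))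
  u = (c - k , k - c) , ≤-trans 0≤1 c-k≥1 , ≡0⇒≥0 (sum-cancel k c)

  st : (k , - k) · (suc k , - k) ≡ (k + k , - (k + k))
  st = trans (·-dominated k (- k) (suc k) (- k)
               (≤-trans (≤-reflexive (suc-x-x k)) k≥1))
             (cong₂ _,_ (x--x k) (-x+-x k))
  su : (k , - k) · (c - k , k - c) ≡ (c , - c)
  su = trans (·-dominated k (- k) (c - k) (k - c)
               (≤-trans (≤-reflexive (sum-cancel k c)) k≥0))
             (cong₂ _,_ (x-[x-y] k c) (-x+[x-y] k c))
  ut : (c - k , k - c) · (suc k , - k) ≡ (c , - c)
  ut = trans (·-dominated (c - k) (k - c) (suc k) (- k)
               (≤-trans (≤-reflexive (suc-x-x k)) c-k≥1))
             (cong₂ _,_ ([y-x]--x k c) ([x-y]+-x k c))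

  open ≡-Reasoning
  -- u shares its second coordinate with s or t only if c = 2k.
  c≡2k : - k ≡ k - c → c ≡ k + k
  c≡2k -k≡k-c = begin
    c            ≡⟨ sym (x-[x-y] k c) ⟩
    k - (k - c)  ≡⟨ cong (λ x → k - x) (sym -k≡k-c) ⟩
    k - - k      ≡⟨ x--x k ⟩
    k + k        ∎

  s≢t : proj₁ s ≢ proj₁ t
  s≢t = i≢suc[i] ∘ cong proj₁
  s≢u : proj₁ s ≢ proj₁ u
  s≢u = c≢2k ∘ c≡2k ∘ cong proj₂
  u≢t : proj₁ u ≢ proj₁ t
  u≢t = c≢2k ∘ c≡2k ∘ sym ∘ cong proj₂

*2≡+ : ∀ n → n ℕ.* 2 ≡ n ℕ.+ n
*2≡+ n = trans (ℕ.*-suc n 1) (cong (n ℕ.+_) (ℕ.*-identityʳ n))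

halve : (a : ℤ) → a ≥ + 2 → + 2 ∣ a → ∃ λ k → + 1 ≤ k × a ≡ k + k
halve (+ n) (+≤+ ()) (divides ℕ.zero refl)
halve (+ n) _        (divides (ℕ.suc q) n≡q*2) =
  + ℕ.suc q , +≤+ (ℕ.s≤s ℕ.z≤n) , cong +_ (trans n≡q*2 (*2≡+ (ℕ.suc q)))

-- The theorem when a ≤ c: with a = 2k we have c - k ≥ a - k = k ≥ 1.
unavoidable-ordered : (a c : ℤ) → a ≥ + 2 → + 2 ∣ a → a ≤ c → a ≢ c →
  Unavoidable (Pair a c)
unavoidable-ordered a c a≥2 2∣a a≤c a≢c with halve a a≥2 2∣a
... | k , k≥1 , refl = unavoidable-double k c k≥1 c-k≥1 (a≢c ∘ sym)
  where
  [x+x]-x : ∀ x → (x + x) - x ≡ x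
  [x+x]-x = solve-∀
  c-k≥1 : + 1 ≤ c - k
  c-k≥1 = ≤-trans k≥1
            (≤-trans (≤-reflexive (sym ([x+x]-x k))) (+-monoˡ-≤ (- k) a≤c))

mainTheorem5 : (a c : ℤ) → a ≥ + 2 → c ≥ + 2 → + 2 ∣ a → + 2 ∣ c → a ≢ c →
    Unavoidable (λ p → (p ≡ (a , - a)) ⊎ (p ≡ (c , - c)))
mainTheorem5 a c a≥2 c≥2 2∣a 2∣c a≢c with ≤-total a c
... | inj₁ a≤c = unavoidable-ordered a c a≥2 2∣a a≤c a≢c
... | inj₂ c≤a = unavoidable-mono (Pair-swap c a)
                   (unavoidable-ordered c a c≥2 2∣c c≤a (a≢c ∘ sym))
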